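{- Let $t$ be a positive integer and $v=4(t+1)$. There exists a minimal $(v,k,t)$ trade $T=\{T^{(1)},T^{(2)}\}$ of volume $2^t$ on the point set $[v]=\{1,\ldots,v\}$ such that both $T^{(1)}$ and $T^{(2)}$ are perfectly balanced: every block has the same size $k=2(t+1)$ and every block has block-sum equal to $(t+1)(4t+5)$.
   Context: For a positive integer $k<v$, let $P_k(v)$ denote the set of all $k$-element subsets (blocks) of $[v]=\{1,\ldots,v\}$. A $(v,k,t)$ trade is a pair $\{T^{(1)},T^{(2)}\}$ with $T^{(1)},T^{(2)}\subseteq P_k(v)$, $|T^{(1)}|=|T^{(2)}|$, $T^{(1)}\cap T^{(2)}=\emptyset$, such that for every $t$-element subset $B_t\subseteq[v]$ the number of blocks of $T^{(1)}$ containing $B_t$ equals the number of blocks of $T^{(2)}$ containing $B_t$. Its volume is $|T^{(1)}|=|T^{(2)}|$. A $(v,k,t)$ trade is minimal if it has the smallest possible volume among $(v,k,t)$ trades. The block-sum of a block $B$ is $\sum_{b\in B} b$. -}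

module Defs where

open import Data.Nat using (ℕ; suc; _<_; _≤_)
open import Data.Fin using (Fin; toℕ)
open import Data.Fin.Subset using (Subset; _⊆_; _∈_; ∣_∣)
open import Data.Fin.Subset.Properties using (_⊆?_; _∈?_)
open import Data.List using (List; []; length; filter; map; allFin)
open import Data.Nat.ListAction using (sum)
open import Data.List.Relation.Unary.All using (All)
open import Data.List.Relation.Unary.Unique.Propositional using (Unique)
open import Data.List.Membership.Propositional using (_∉_)
open import Data.Product using (_×_)
open import Relation.Binary.PropositionalEquality using (_≡_; _≢_)

-- A block is a subset of [v]; element i : Fin v stands for the point (toℕ i + 1).
Block : ℕ → Set
Block v = Subset v

-- A family of blocks is a duplicate-free list of blocks (i.e. a finite set of blocks).
-- Number of blocks of T containing B.
count : ∀ {v} → Subset v → List (Block v) → ℕ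
count B T = length (filter (B ⊆?_) T)

blockSum : ∀ {v} → Block v → ℕ
blockSum {v} B = sum (map (λ i → suc (toℕ i)) (filter (_∈? B) (allFin v)))

record IsTrade (v k t : ℕ) (T1 T2 : List (Block v)) : Set where
  field
    k-pos      : 0 < k
    k<v        : k < v
    uniq₁      : Unique T1
    uniq₂      : Unique T2
    size₁      : All (λ B → ∣ B ∣ ≡ k) T1
    size₂      : All (λ B → ∣ B ∣ ≡ k) T2
    sameVolume : length T1 ≡ length T2
    nonempty   : T1 ≢ []
    disjoint   : All (λ B → B ∉ T2) T1
    balanced   : (Bt : Subset v) → ∣ Bt ∣ ≡ t → count Bt T1 ≡ count Bt T2

volume : ∀ {v} → List (Block v) → ℕ
volume T = length T

IsMinimalTrade : (v k t : ℕ) (T1 T2 : List (Block v)) → Set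
IsMinimalTrade v k t T1 T2 =
  IsTrade v k t T1 T2 ×
  ((S1 S2 : List (Block v)) → IsTrade v k t S1 S2 → volume T1 ≤ volume S1)

{-# OPTIONS --safe #-}
-- Every block takes, from each quadruple {4i+1, …, 4i+4}, either its outer pair {4i+1, 4i+4} or its
-- inner pair {4i+2, 4i+3}; T₁ and T₂ collect the blocks with an even and an odd number of inner pairs.
-- Both pairs have two points and sum 8i+5, which fixes the size and the block-sum of every block. A set
-- of at most t points misses one of the t+1 quadruples, and toggling the choice there matches the blocks
-- of T₁ containing it with those of T₂. Minimality is the classical bound 2^t on the volume of a
-- (v,k,t) trade: with constant block size, agreement on t-sets implies agreement on all smaller sets,
-- and splitting a trade at a point that separates a block of T₁ from a block of T₂ yields a derived and
-- a residual (t−1)-trade, both nonempty.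
module Submission where

open import Defs
open import Data.Bool using (true; false; if_then_else_; _∧_)
open import Data.Empty using (⊥-elim)
open import Data.Fin using (Fin; zero; suc; toℕ)
open import Data.Fin.Subset using (Subset; inside; outside; _⊆_; _∈_; _∉_; ⊥; ⁅_⁆; _∪_; ∣_∣)
open import Data.Fin.Subset.Properties
  using (_⊆?_; _∈?_; ⊆-min; ∪-identityʳ; ∣⊥∣≡0; x∈⁅x⁆; x∈⁅y⁆⇒x≡y;
         p⊆p∪q; q⊆p∪q; x∈p∪q⁻; drop-there)
open import Data.List using (List; []; _∷_; _++_; length; filter; map; allFin; tabulate)
open import Data.List.Properties
  using (map-cong-local; map-tabulate; map-∘; length-++; length-map;
         filter-all; filter-++; filter-≐; filter-accept; filter-reject; filter-some)
open import Data.List.Membership.Propositional using () renaming (_∈_ to _∈ₗ_; _∉_ to _∉ₗ_)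
open import Data.List.Membership.Propositional.Properties using (∈-filter⁻; ∈-map⁻; ∈-++⁻)
open import Data.List.Relation.Binary.Disjoint.Propositional using (Disjoint)
open import Data.List.Relation.Binary.Disjoint.Propositional.Properties using () renaming (sym to Disjoint-sym)
open import Data.List.Relation.Unary.All as All using (All; []; _∷_)
open import Data.List.Relation.Unary.All.Properties
  using () renaming (filter⁺ to All-filter⁺; map⁺ to All-map⁺; ++⁺ to All-++⁺)
open import Data.List.Relation.Unary.AllPairs using ([]; _∷_)
import Data.List.Relation.Unary.Any as Any
open import Data.List.Relation.Unary.Unique.Propositional using (Unique)
open import Data.List.Relation.Unary.Unique.Propositional.Properties
  using () renaming (++⁺ to Unique-++⁺; map⁺ to Unique-map⁺)
open import Data.Nat using (ℕ; zero; suc; _+_; _*_; _∸_; _^_; _≤_; _<_; z≤n; s≤s; z<s; s<s; s<s⁻¹; >-nonZero)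
open import Data.Nat.ListAction using (sum)
open import Data.Nat.Properties
  using (+-suc; +-identityʳ; +-comm; +-cancelˡ-≡; +-cancelʳ-≡; +-mono-≤; +-monoˡ-≤; +-commutativeSemigroup;
         *-comm; *-zeroʳ; *-suc; *-distribʳ-+; *-cancelˡ-≡; *-monoˡ-<; m^n>0;
         m∸n+n≡m; m+[n∸m]≡n; m<n⇒0<n∸m;
         ≤-reflexive; ≤-trans; <-≤-trans; ≤-<-trans; <⇒≤; <⇒≢; n≤1+n; m≤m+n; m<m+n; m≤n⇒m≤1+n;
         module ≤-Reasoning)
open import Algebra.Properties.CommutativeSemigroup +-commutativeSemigroup using (interchange; x∙yz≈y∙xz)
open import Data.Nat.Tactic.RingSolver using (solve-∀)
import Data.Product as Product
open import Data.Product using (Σ; ∃-syntax; _×_; _,_; proj₁; proj₂; swap)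
import Data.Sum as Sum
open import Data.Sum using (_⊎_; inj₁; inj₂; [_,_])
open import Data.Vec using (Vec; []; _∷_; here; there; splitAt) renaming (_++_ to _++ᵛ_)
open import Data.Vec.Properties using (++-injectiveˡ; ++-injectiveʳ)
open import Function using (id; _∘_)
open import Relation.Binary.PropositionalEquality
  using (_≡_; _≢_; refl; sym; trans; cong; cong₂; subst; module ≡-Reasoning)
open import Relation.Nullary using (Dec; does; yes; no)
open import Relation.Nullary.Decidable using (dec-true)
open import Relation.Unary using (Pred; Decidable)
open import Relation.Unary.Properties using (∁?; _∩?_)

private variable
  m n : ℕ

module _ {a p q} {A : Set a} {P : Pred A p} {Q : Pred A q} (P? : Decidable P) (Q? : Decidable Q) where

  filter-∩ : ∀ xs → filter P? (filter Q? xs) ≡ filter (P? ∩? Q?) xs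
  filter-∩ [] = refl
  filter-∩ (x ∷ xs) = by-cases (P? x) (Q? x)
    where
    open ≡-Reasoning
    by-cases : Dec (P x) → Dec (Q x) → filter P? (filter Q? (x ∷ xs)) ≡ filter (P? ∩? Q?) (x ∷ xs)
    by-cases _ (no ¬q) = begin
      filter P? (filter Q? (x ∷ xs))  ≡⟨ cong (filter P?) (filter-reject Q? ¬q) ⟩
      filter P? (filter Q? xs)        ≡⟨ filter-∩ xs ⟩
      filter (P? ∩? Q?) xs            ≡⟨ filter-reject (P? ∩? Q?) (¬q ∘ proj₂) ⟨
      filter (P? ∩? Q?) (x ∷ xs)      ∎
    by-cases (no ¬p) (yes q) = begin
      filter P? (filter Q? (x ∷ xs))  ≡⟨ cong (filter P?) (filter-accept Q? q) ⟩
      filter P? (x ∷ filter Q? xs)    ≡⟨ filter-reject P? ¬p ⟩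
      filter P? (filter Q? xs)        ≡⟨ filter-∩ xs ⟩
      filter (P? ∩? Q?) xs            ≡⟨ filter-reject (P? ∩? Q?) (¬p ∘ proj₁) ⟨
      filter (P? ∩? Q?) (x ∷ xs)      ∎
    by-cases (yes p) (yes q) = begin
      filter P? (filter Q? (x ∷ xs))  ≡⟨ cong (filter P?) (filter-accept Q? q) ⟩
      filter P? (x ∷ filter Q? xs)    ≡⟨ filter-accept P? p ⟩
      x ∷ filter P? (filter Q? xs)    ≡⟨ cong (x ∷_) (filter-∩ xs) ⟩
      x ∷ filter (P? ∩? Q?) xs        ≡⟨ filter-accept (P? ∩? Q?) (p , q) ⟨
      filter (P? ∩? Q?) (x ∷ xs)      ∎

filter-swap : ∀ {a p q} {A : Set a} {P : Pred A p} {Q : Pred A q} (P? : Decidable P) (Q? : Decidable Q) →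
              ∀ xs → filter P? (filter Q? xs) ≡ filter Q? (filter P? xs)
filter-swap P? Q? xs = begin
  filter P? (filter Q? xs)  ≡⟨ filter-∩ P? Q? xs ⟩
  filter (P? ∩? Q?) xs      ≡⟨ filter-≐ (P? ∩? Q?) (Q? ∩? P?) (swap , swap) xs ⟩
  filter (Q? ∩? P?) xs      ≡⟨ filter-∩ Q? P? xs ⟨
  filter Q? (filter P? xs)  ∎
  where open ≡-Reasoning

module _ {a p} {A : Set a} {P : Pred A p} (P? : Decidable P) where

  length-filter-∁ : ∀ xs → length (filter P? xs) + length (filter (∁? P?) xs) ≡ length xs
  length-filter-∁ [] = refl
  length-filter-∁ (x ∷ xs) with does (P? x)
  ... | true  = cong suc (length-filter-∁ xs)
  ... | false = trans (+-suc _ _) (cong suc (length-filter-∁ xs))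

count-⊥ : (T : List (Subset n)) → count ⊥ T ≡ length T
count-⊥ T = cong length (filter-all (⊥ ⊆?_) (All.universal ⊆-min T))

count-++ : (S : Subset n) (X Y : List (Subset n)) → count S (X ++ Y) ≡ count S X + count S Y
count-++ S X Y = trans (cong length (filter-++ (S ⊆?_) X Y)) (length-++ (filter (S ⊆?_) X))

count-split : ∀ {q} {Q : Pred (Subset n) q} (Q? : Decidable Q) (S : Subset n) T →
              count S (filter Q? T) + count S (filter (∁? Q?) T) ≡ count S T
count-split Q? S T = begin
  count S (filter Q? T) + count S (filter (∁? Q?) T)
    ≡⟨ cong₂ (λ X Y → length X + length Y) (filter-swap (S ⊆?_) Q? T) (filter-swap (S ⊆?_) (∁? Q?) T) ⟩
  length (filter Q? (filter (S ⊆?_) T)) + length (filter (∁? Q?) (filter (S ⊆?_) T))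
    ≡⟨ length-filter-∁ Q? (filter (S ⊆?_) T) ⟩
  count S T ∎
  where open ≡-Reasoning

∪⁅⁆-⊆ : (S C : Subset n) (x : Fin n) → S ∪ ⁅ x ⁆ ⊆ C → S ⊆ C × x ∈ C
∪⁅⁆-⊆ S C x S∪x⊆C =
  (λ y∈S → S∪x⊆C (p⊆p∪q ⁅ x ⁆ y∈S)) , S∪x⊆C (q⊆p∪q S ⁅ x ⁆ (x∈⁅x⁆ x))

⊆-∪⁅⁆ : (S C : Subset n) (x : Fin n) → S ⊆ C × x ∈ C → S ∪ ⁅ x ⁆ ⊆ C
⊆-∪⁅⁆ S C x (S⊆C , x∈C) y∈S∪x =
  [ S⊆C , (λ y∈⁅x⁆ → subst (_∈ C) (sym (x∈⁅y⁆⇒x≡y x y∈⁅x⁆)) x∈C) ]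
    (x∈p∪q⁻ S ⁅ x ⁆ y∈S∪x)

count-filter-∈ : (S : Subset n) (x : Fin n) (T : List (Subset n)) →
                 count S (filter (x ∈?_) T) ≡ count (S ∪ ⁅ x ⁆) T
count-filter-∈ S x T = cong length (begin
  filter (S ⊆?_) (filter (x ∈?_) T)  ≡⟨ filter-∩ (S ⊆?_) (x ∈?_) T ⟩
  filter ((S ⊆?_) ∩? (x ∈?_)) T      ≡⟨ filter-≐ _ ((S ∪ ⁅ x ⁆) ⊆?_) (⊆-∪⁅⁆ S _ x , ∪⁅⁆-⊆ S _ x) T ⟩
  filter ((S ∪ ⁅ x ⁆) ⊆?_) T         ∎)
  where open ≡-Reasoning

∣p∪⁅x⁆∣≤1+∣p∣ : (p : Subset n) (x : Fin n) → ∣ p ∪ ⁅ x ⁆ ∣ ≤ suc ∣ p ∣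
∣p∪⁅x⁆∣≤1+∣p∣ (inside  ∷ p) zero    = s≤s (≤-trans (≤-reflexive (cong ∣_∣ (∪-identityʳ p))) (n≤1+n _))
∣p∪⁅x⁆∣≤1+∣p∣ (outside ∷ p) zero    = s≤s (≤-reflexive (cong ∣_∣ (∪-identityʳ p)))
∣p∪⁅x⁆∣≤1+∣p∣ (inside  ∷ p) (suc x) = s≤s (∣p∪⁅x⁆∣≤1+∣p∣ p x)
∣p∪⁅x⁆∣≤1+∣p∣ (outside ∷ p) (suc x) = ∣p∪⁅x⁆∣≤1+∣p∣ p x

derived residual : Fin n → List (Subset n) → List (Subset n)
derived  x = filter (x ∈?_)
residual x = filter (∁? (x ∈?_))

record Balanced (t : ℕ) (T₁ T₂ : List (Subset n)) : Set where
  constructor balanced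
  field count≡ : ∀ S → ∣ S ∣ ≤ t → count S T₁ ≡ count S T₂

open Balanced

private variable
  t : ℕ

Balanced⇒length≡ : {T₁ T₂ : List (Subset n)} → Balanced t T₁ T₂ → length T₁ ≡ length T₂
Balanced⇒length≡ {n} {T₁ = T₁} {T₂ = T₂} bal = begin
  length T₁   ≡⟨ count-⊥ T₁ ⟨
  count ⊥ T₁  ≡⟨ count≡ bal ⊥ (≤-trans (≤-reflexive (∣⊥∣≡0 n)) z≤n) ⟩
  count ⊥ T₂  ≡⟨ count-⊥ T₂ ⟩
  length T₂   ∎
  where open ≡-Reasoning

derived-balanced : ∀ x {T₁ T₂ : List (Subset n)} → Balanced (suc t) T₁ T₂ →
                   Balanced t (derived x T₁) (derived x T₂)
derived-balanced x {T₁} {T₂} bal = balanced λ S ∣S∣≤t → begin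
  count S (derived x T₁)  ≡⟨ count-filter-∈ S x T₁ ⟩
  count (S ∪ ⁅ x ⁆) T₁    ≡⟨ count≡ bal _ (≤-trans (∣p∪⁅x⁆∣≤1+∣p∣ S x) (s≤s ∣S∣≤t)) ⟩
  count (S ∪ ⁅ x ⁆) T₂    ≡⟨ count-filter-∈ S x T₂ ⟨
  count S (derived x T₂)  ∎
  where open ≡-Reasoning

residual-balanced : ∀ x {T₁ T₂ : List (Subset n)} → Balanced (suc t) T₁ T₂ →
                    Balanced t (residual x T₁) (residual x T₂)
residual-balanced x {T₁} {T₂} bal = balanced λ S ∣S∣≤t →
  +-cancelˡ-≡ (count S (derived x T₁)) _ _ (begin
    count S (derived x T₁) + count S (residual x T₁)  ≡⟨ count-split (x ∈?_) S T₁ ⟩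
    count S T₁                                        ≡⟨ count≡ bal S (m≤n⇒m≤1+n ∣S∣≤t) ⟩
    count S T₂                                        ≡⟨ count-split (x ∈?_) S T₂ ⟨
    count S (derived x T₂) + count S (residual x T₂)
      ≡⟨ cong (_+ count S (residual x T₂)) (count≡ (derived-balanced x bal) S ∣S∣≤t) ⟨
    count S (derived x T₁) + count S (residual x T₂)  ∎)
  where open ≡-Reasoning

filter-disjoint : ∀ {p} {T₁ T₂ : List (Subset n)} {P : Pred (Subset n) p} (P? : Decidable P) →
                  All (_∉ₗ T₂) T₁ → All (_∉ₗ filter P? T₂) (filter P? T₁)
filter-disjoint P? disj = All-filter⁺ P? (All.map (λ B∉T₂ B∈ → B∉T₂ (proj₁ (∈-filter⁻ P? B∈))) disj)

Separates : Fin n → Subset n → Subset n → Set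
Separates x B B′ = (x ∈ B × x ∉ B′) ⊎ (x ∉ B × x ∈ B′)

separates-there : ∀ {s} {x : Fin n} {B B′} → Separates x B B′ → Separates (suc x) (s ∷ B) (s ∷ B′)
separates-there (inj₁ (x∈B , x∉B′)) = inj₁ (there x∈B , x∉B′ ∘ drop-there)
separates-there (inj₂ (x∉B , x∈B′)) = inj₂ (x∉B ∘ drop-there , there x∈B′)

separating-point : (B B′ : Subset n) → B ≢ B′ → ∃[ x ] Separates x B B′
separating-point []            []             B≢B′ = ⊥-elim (B≢B′ refl)
separating-point (inside  ∷ B) (outside ∷ B′) _    = zero , inj₁ (here , λ ())
separating-point (outside ∷ B) (inside  ∷ B′) _    = zero , inj₂ ((λ ()) , here)
separating-point (inside  ∷ B) (inside  ∷ B′) B≢B′ =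
  Product.map suc separates-there (separating-point B B′ (B≢B′ ∘ cong (inside ∷_)))
separating-point (outside ∷ B) (outside ∷ B′) B≢B′ =
  Product.map suc separates-there (separating-point B B′ (B≢B′ ∘ cong (outside ∷_)))

2^t≤length : ∀ t {T₁ T₂ : List (Subset n)} →
             All (_∉ₗ T₂) T₁ → Balanced t T₁ T₂ → 0 < length T₁ → 2 ^ t ≤ length T₁
2^t≤length zero _ _ 0<∣T₁∣ = 0<∣T₁∣
2^t≤length (suc t) {B ∷ T₁} {[]} _ bal _ with Balanced⇒length≡ bal
... | ()
2^t≤length (suc t) {B ∷ T₁} {B′ ∷ T₂} disj bal _
  with x , x-separates ← separating-point B B′ (λ B≡B′ → All.head disj (Any.here B≡B′)) = begin
  2 ^ t + (2 ^ t + 0)                                  ≡⟨ cong (2 ^ t +_) (+-identityʳ (2 ^ t)) ⟩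
  2 ^ t + 2 ^ t                                        ≤⟨ +-mono-≤ ∣derived∣ ∣residual∣ ⟩
  length (derived x (B ∷ T₁)) + length (residual x (B ∷ T₁))  ≡⟨ length-filter-∁ (x ∈?_) (B ∷ T₁) ⟩
  length (B ∷ T₁)                                      ∎
  where
  open ≤-Reasoning
  -- B lands on one side of x and B′ on the other; balance transfers nonemptiness from T₂'s side to T₁'s.
  nonempty : Separates x B B′ → 0 < length (derived x (B ∷ T₁)) × 0 < length (residual x (B ∷ T₁))
  nonempty (inj₁ (x∈B , x∉B′)) =
    filter-some (x ∈?_) (Any.here x∈B) ,
    subst (0 <_) (sym (Balanced⇒length≡ (residual-balanced x bal))) (filter-some (∁? (x ∈?_)) (Any.here x∉B′))
  nonempty (inj₂ (x∉B , x∈B′)) =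
    subst (0 <_) (sym (Balanced⇒length≡ (derived-balanced x bal))) (filter-some (x ∈?_) (Any.here x∈B′)) ,
    filter-some (∁? (x ∈?_)) (Any.here x∉B)
  ∣derived∣ : 2 ^ t ≤ length (derived x (B ∷ T₁))
  ∣derived∣ =
    2^t≤length t (filter-disjoint (x ∈?_) disj) (derived-balanced x bal) (proj₁ (nonempty x-separates))
  ∣residual∣ : 2 ^ t ≤ length (residual x (B ∷ T₁))
  ∣residual∣ =
    2^t≤length t (filter-disjoint (∁? (x ∈?_)) disj) (residual-balanced x bal) (proj₂ (nonempty x-separates))

extensions : Subset n → List (Subset n)
extensions []            = []
extensions (outside ∷ S) = (inside ∷ S) ∷ map (outside ∷_) (extensions S)
extensions (inside  ∷ S) = map (inside ∷_) (extensions S)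

∣extensions∣ : (S : Subset n) → All (λ E → ∣ E ∣ ≡ suc ∣ S ∣) (extensions S)
∣extensions∣ []            = []
∣extensions∣ (outside ∷ S) = refl ∷ All-map⁺ (∣extensions∣ S)
∣extensions∣ (inside  ∷ S) = All-map⁺ (All.map (cong suc) (∣extensions∣ S))

count-within : Subset n → List (Subset n) → ℕ
count-within C L = length (filter (_⊆? C) L)

count-within-outside : ∀ s (C : Subset n) L → count-within (s ∷ C) (map (outside ∷_) L) ≡ count-within C L
count-within-outside s C []      = refl
count-within-outside s C (E ∷ L) with does (E ⊆? C)
... | true  = cong suc (count-within-outside s C L)
... | false = count-within-outside s C L

count-within-inside : ∀ (C : Subset n) L → count-within (inside ∷ C) (map (inside ∷_) L) ≡ count-within C L
count-within-inside C []      = refl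
count-within-inside C (E ∷ L) with does (E ⊆? C)
... | true  = cong suc (count-within-inside C L)
... | false = count-within-inside C L

count-within-inside-outside : ∀ (C : Subset n) L → count-within (outside ∷ C) (map (inside ∷_) L) ≡ 0
count-within-inside-outside C []      = refl
count-within-inside-outside C (E ∷ L) = count-within-inside-outside C L

extensions-within : (S C : Subset n) →
  count-within C (extensions S) + (if does (S ⊆? C) then ∣ S ∣ else 0) ≡
  (if does (S ⊆? C) then ∣ C ∣ else 0)
extensions-within [] [] = refl
extensions-within (outside ∷ S) (outside ∷ C) =
  trans (cong (_+ (if does (S ⊆? C) then ∣ S ∣ else 0)) (count-within-outside outside C (extensions S)))
        (extensions-within S C)
extensions-within (outside ∷ S) (inside ∷ C) with does (S ⊆? C) | extensions-within S C
... | true  | ih = cong suc (trans (cong (_+ ∣ S ∣) (count-within-outside inside C (extensions S))) ih)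
... | false | ih = trans (cong (_+ 0) (count-within-outside inside C (extensions S))) ih
extensions-within (inside ∷ S) (outside ∷ C) = cong (_+ 0) (count-within-inside-outside C (extensions S))
extensions-within (inside ∷ S) (inside ∷ C) with does (S ⊆? C) | extensions-within S C
... | true  | ih =
  trans (+-suc _ ∣ S ∣) (cong suc (trans (cong (_+ ∣ S ∣) (count-within-inside C (extensions S))) ih))
... | false | ih = trans (cong (_+ 0) (count-within-inside C (extensions S))) ih

counts : List (Subset n) → List (Subset n) → ℕ
counts L T = sum (map (λ E → count E T) L)

counts-[] : (L : List (Subset n)) → counts L [] ≡ 0
counts-[] []      = refl
counts-[] (_ ∷ L) = counts-[] L

counts-∷ : ∀ (L : List (Subset n)) C T → counts L (C ∷ T) ≡ count-within C L + counts L T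
counts-∷ []      C T = refl
counts-∷ (E ∷ L) C T with does (E ⊆? C)
... | true  = cong suc (trans (cong (count E T +_) (counts-∷ L C T)) (x∙yz≈y∙xz (count E T) _ (counts L T)))
... | false = trans (cong (count E T +_) (counts-∷ L C T)) (x∙yz≈y∙xz (count E T) _ (counts L T))

-- Double counting: a block C ⊇ S of size k contains exactly k − ∣ S ∣ of the extensions of S.
counts-extensions : ∀ {k} (S : Subset n) T → All (λ C → ∣ C ∣ ≡ k) T →
                    counts (extensions S) T + ∣ S ∣ * count S T ≡ k * count S T
counts-extensions {k = k} S [] [] = begin
  counts (extensions S) [] + ∣ S ∣ * 0  ≡⟨ cong₂ _+_ (counts-[] (extensions S)) (*-zeroʳ ∣ S ∣) ⟩
  0                                     ≡⟨ *-zeroʳ k ⟨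
  k * 0                                 ∎
  where open ≡-Reasoning
counts-extensions {k = k} S (C ∷ T) (∣C∣≡k ∷ ∣T∣≡k) rewrite counts-∷ (extensions S) C T
  with does (S ⊆? C) | extensions-within S C
... | true | within = begin
  within-C + counts (extensions S) T + ∣ S ∣ * suc (count S T)
    ≡⟨ cong (within-C + counts (extensions S) T +_) (*-suc ∣ S ∣ (count S T)) ⟩
  within-C + counts (extensions S) T + (∣ S ∣ + ∣ S ∣ * count S T)
    ≡⟨ interchange within-C (counts (extensions S) T) ∣ S ∣ (∣ S ∣ * count S T) ⟩
  (within-C + ∣ S ∣) + (counts (extensions S) T + ∣ S ∣ * count S T)
    ≡⟨ cong₂ _+_ (trans within ∣C∣≡k) (counts-extensions S T ∣T∣≡k) ⟩
  k + k * count S T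
    ≡⟨ *-suc k (count S T) ⟨
  k * suc (count S T) ∎
  where
  open ≡-Reasoning
  within-C = count-within C (extensions S)
... | false | within = begin
  count-within C (extensions S) + counts (extensions S) T + ∣ S ∣ * count S T
    ≡⟨ cong (λ c → c + counts (extensions S) T + ∣ S ∣ * count S T) (trans (sym (+-identityʳ _)) within) ⟩
  counts (extensions S) T + ∣ S ∣ * count S T
    ≡⟨ counts-extensions S T ∣T∣≡k ⟩
  k * count S T ∎
  where open ≡-Reasoning

BalancedOn : ℕ → List (Subset n) → List (Subset n) → Set
BalancedOn s T₁ T₂ = ∀ S → ∣ S ∣ ≡ s → count S T₁ ≡ count S T₂

BalancedOn-pred : ∀ {k s} {T₁ T₂ : List (Subset n)} →
                  All (λ C → ∣ C ∣ ≡ k) T₁ → All (λ C → ∣ C ∣ ≡ k) T₂ → s < k →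
                  BalancedOn (suc s) T₁ T₂ → BalancedOn s T₁ T₂
BalancedOn-pred {n} {k} {T₁ = T₁} {T₂} ∣T₁∣≡k ∣T₂∣≡k s<k bal S refl =
  *-cancelˡ-≡ (count S T₁) (count S T₂) (k ∸ ∣ S ∣) {{>-nonZero (m<n⇒0<n∸m s<k)}} (begin
    (k ∸ ∣ S ∣) * count S T₁  ≡⟨ counts-extensions′ T₁ ∣T₁∣≡k ⟨
    counts (extensions S) T₁  ≡⟨ cong sum (map-cong-local (All.map (bal _) (∣extensions∣ S))) ⟩
    counts (extensions S) T₂  ≡⟨ counts-extensions′ T₂ ∣T₂∣≡k ⟩
    (k ∸ ∣ S ∣) * count S T₂  ∎)
  where
  open ≡-Reasoning
  counts-extensions′ : ∀ T → All (λ C → ∣ C ∣ ≡ k) T →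
                       counts (extensions S) T ≡ (k ∸ ∣ S ∣) * count S T
  counts-extensions′ T ∣T∣≡k = +-cancelʳ-≡ (∣ S ∣ * count S T) _ _ (begin
    counts (extensions S) T + ∣ S ∣ * count S T  ≡⟨ counts-extensions S T ∣T∣≡k ⟩
    k * count S T                                ≡⟨ cong (_* count S T) (m∸n+n≡m (<⇒≤ s<k)) ⟨
    (k ∸ ∣ S ∣ + ∣ S ∣) * count S T              ≡⟨ *-distribʳ-+ (count S T) (k ∸ ∣ S ∣) ∣ S ∣ ⟩
    (k ∸ ∣ S ∣) * count S T + ∣ S ∣ * count S T  ∎)

BalancedOn⇒Balanced : ∀ {k t} {T₁ T₂ : List (Subset n)} →
                      All (λ C → ∣ C ∣ ≡ k) T₁ → All (λ C → ∣ C ∣ ≡ k) T₂ → t ≤ k →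
                      BalancedOn t T₁ T₂ → Balanced t T₁ T₂
BalancedOn⇒Balanced {k = k} {t} {T₁} {T₂} ∣T₁∣≡k ∣T₂∣≡k t≤k bal =
  balanced λ S ∣S∣≤t → below ∣ S ∣ (t ∸ ∣ S ∣) (m+[n∸m]≡n ∣S∣≤t) S refl
  where
  below : ∀ s d → s + d ≡ t → BalancedOn s T₁ T₂
  below s zero    s+0≡t   = subst (λ s → BalancedOn s T₁ T₂) (trans (sym s+0≡t) (+-identityʳ s)) bal
  below s (suc d) s+1+d≡t =
    BalancedOn-pred ∣T₁∣≡k ∣T₂∣≡k s<k (below (suc s) d (trans (sym (+-suc s d)) s+1+d≡t))
    where
    s<k : s < k
    s<k = <-≤-trans (subst (s <_) s+1+d≡t (m<m+n s z<s)) t≤k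

IsTrade⇒2^t≤volume : ∀ {v k t} {T₁ T₂ : List (Block v)} →
                     IsTrade v k t T₁ T₂ → t ≤ k → 2 ^ t ≤ volume T₁
IsTrade⇒2^t≤volume {T₁ = []}    trade _   = ⊥-elim (IsTrade.nonempty trade refl)
IsTrade⇒2^t≤volume {T₁ = _ ∷ _} trade t≤k =
  2^t≤length _ (IsTrade.disjoint trade)
    (BalancedOn⇒Balanced (IsTrade.size₁ trade) (IsTrade.size₂ trade) t≤k (IsTrade.balanced trade)) z<s

does-⊆?-++ᵛ : (q p : Subset m) (S C : Subset n) →
              does (q ++ᵛ S ⊆? p ++ᵛ C) ≡ does (q ⊆? p) ∧ does (S ⊆? C)
does-⊆?-++ᵛ []            []            S C = refl
does-⊆?-++ᵛ (outside ∷ q) (_ ∷ p)       S C = does-⊆?-++ᵛ q p S C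
does-⊆?-++ᵛ (inside ∷ q)  (outside ∷ p) S C = refl
does-⊆?-++ᵛ (inside ∷ q)  (inside ∷ p)  S C = does-⊆?-++ᵛ q p S C

count-map-++ᵛ : (q p : Subset m) (S : Subset n) (X : List (Subset n)) →
                count (q ++ᵛ S) (map (p ++ᵛ_) X) ≡ (if does (q ⊆? p) then count S X else 0)
count-map-++ᵛ q p S [] with does (q ⊆? p)
... | true  = refl
... | false = refl
count-map-++ᵛ q p S (C ∷ X) rewrite does-⊆?-++ᵛ q p S C
  with does (q ⊆? p) | does (S ⊆? C) | count-map-++ᵛ q p S X
... | true  | true  | ih = cong suc ih
... | true  | false | ih = ih
... | false | _     | ih = ih

∣p++q∣≡∣p∣+∣q∣ : (p : Subset m) (q : Subset n) → ∣ p ++ᵛ q ∣ ≡ ∣ p ∣ + ∣ q ∣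
∣p++q∣≡∣p∣+∣q∣ []            q = refl
∣p++q∣≡∣p∣+∣q∣ (outside ∷ p) q = ∣p++q∣≡∣p∣+∣q∣ p q
∣p++q∣≡∣p∣+∣q∣ (inside ∷ p)  q = cong suc (∣p++q∣≡∣p∣+∣q∣ p q)

⊥-or-nonempty : (p : Subset m) → p ≡ ⊥ ⊎ 0 < ∣ p ∣
⊥-or-nonempty []            = inj₁ refl
⊥-or-nonempty (inside ∷ p)  = inj₂ z<s
⊥-or-nonempty (outside ∷ p) = Sum.map₁ (cong (outside ∷_)) (⊥-or-nonempty p)

++-disjoint : ∀ {A : Set} {X Y Z : List A} → Disjoint X Z → Disjoint Y Z → Disjoint (X ++ Y) Z
++-disjoint {X = X} X#Z Y#Z (v∈X++Y , v∈Z) =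
  [ (λ v∈X → X#Z (v∈X , v∈Z)) , (λ v∈Y → Y#Z (v∈Y , v∈Z)) ] (∈-++⁻ X v∈X++Y)

map-++ᵛ-disjoint : ∀ {A : Set} (p : Vec A m) {X Y : List (Vec A n)} → Disjoint X Y →
                   Disjoint (map (p ++ᵛ_) X) (map (p ++ᵛ_) Y)
map-++ᵛ-disjoint p {Y = Y} X#Y (pX , pY) with ∈-map⁻ _ pX | ∈-map⁻ _ pY
... | x , x∈X , refl | y , y∈Y , px≡py = X#Y (x∈X , subst (_∈ₗ Y) (sym (++-injectiveʳ p p px≡py)) y∈Y)

map-++ᵛ-apart : ∀ {A : Set} {p q : Vec A m} {X Y : List (Vec A n)} → p ≢ q →
                Disjoint (map (p ++ᵛ_) X) (map (q ++ᵛ_) Y)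
map-++ᵛ-apart {p = p} {q} p≢q (pX , qY) with ∈-map⁻ _ pX | ∈-map⁻ _ qY
... | x , _ , refl | y , _ , px≡qy = p≢q (++-injectiveˡ p q px≡qy)

module Choices {m} (a b : Subset m) where

  evenChoices oddChoices : ∀ n → List (Subset (n * m))
  evenChoices zero    = [] ∷ []
  evenChoices (suc n) = map (a ++ᵛ_) (evenChoices n) ++ map (b ++ᵛ_) (oddChoices n)
  oddChoices  zero    = []
  oddChoices  (suc n) = map (a ++ᵛ_) (oddChoices n) ++ map (b ++ᵛ_) (evenChoices n)

  All-choices : (P : ∀ n → Subset (n * m) → Set) → P zero [] →
                (∀ {n} {B : Subset (n * m)} → P n B → P (suc n) (a ++ᵛ B) × P (suc n) (b ++ᵛ B)) →
                ∀ n → All (P n) (evenChoices n) × All (P n) (oddChoices n)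
  All-choices P P[] step zero    = P[] ∷ [] , []
  All-choices P P[] step (suc n) with All-choices P P[] step n
  ... | Peven , Podd =
    All-++⁺ (All-map⁺ (All.map (proj₁ ∘ step) Peven)) (All-map⁺ (All.map (proj₂ ∘ step) Podd)) ,
    All-++⁺ (All-map⁺ (All.map (proj₁ ∘ step) Podd)) (All-map⁺ (All.map (proj₂ ∘ step) Peven))

  length-choices : ∀ n → length (evenChoices (suc n)) ≡ 2 ^ n × length (oddChoices (suc n)) ≡ 2 ^ n
  length-choices zero    = refl , refl
  length-choices (suc n) with length-choices n
  ... | ∣even∣ , ∣odd∣ =
    length-map-++ (evenChoices (suc n)) (oddChoices (suc n)) ∣even∣ ∣odd∣ ,
    length-map-++ (oddChoices (suc n)) (evenChoices (suc n)) ∣odd∣ ∣even∣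
    where
    length-map-++ : ∀ (X Y : List (Subset (suc n * m))) → length X ≡ 2 ^ n → length Y ≡ 2 ^ n →
                    length (map (a ++ᵛ_) X ++ map (b ++ᵛ_) Y) ≡ 2 ^ suc n
    length-map-++ X Y ∣X∣ ∣Y∣ = begin
      length (map (a ++ᵛ_) X ++ map (b ++ᵛ_) Y)       ≡⟨ length-++ (map (a ++ᵛ_) X) ⟩
      length (map (a ++ᵛ_) X) + length (map (b ++ᵛ_) Y) ≡⟨ cong₂ _+_ (length-map _ X) (length-map _ Y) ⟩
      length X + length Y                             ≡⟨ cong₂ _+_ ∣X∣ (trans ∣Y∣ (sym (+-identityʳ _))) ⟩
      2 ^ suc n                                       ∎
      where open ≡-Reasoning

  ∣choices∣ : ∀ {w} → ∣ a ∣ ≡ w → ∣ b ∣ ≡ w → ∀ n →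
              All (λ B → ∣ B ∣ ≡ n * w) (evenChoices n) × All (λ B → ∣ B ∣ ≡ n * w) (oddChoices n)
  ∣choices∣ {w} ∣a∣≡w ∣b∣≡w = All-choices (λ n B → ∣ B ∣ ≡ n * w) refl λ {_} {B} ∣B∣ →
    trans (∣p++q∣≡∣p∣+∣q∣ a B) (cong₂ _+_ ∣a∣≡w ∣B∣) ,
    trans (∣p++q∣≡∣p∣+∣q∣ b B) (cong₂ _+_ ∣b∣≡w ∣B∣)

  choices-unique : a ≢ b → ∀ n →
    Unique (evenChoices n) × Unique (oddChoices n) × Disjoint (evenChoices n) (oddChoices n)
  choices-unique a≢b zero    = [] ∷ [] , [] , λ ()
  choices-unique a≢b (suc n) with choices-unique a≢b n
  ... | even-unique , odd-unique , even#odd =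
    Unique-++⁺ (Unique-map⁺ (++-injectiveʳ a a) even-unique) (Unique-map⁺ (++-injectiveʳ b b) odd-unique)
               (map-++ᵛ-apart a≢b) ,
    Unique-++⁺ (Unique-map⁺ (++-injectiveʳ a a) odd-unique) (Unique-map⁺ (++-injectiveʳ b b) even-unique)
               (map-++ᵛ-apart a≢b) ,
    ++-disjoint
      (Disjoint-sym (++-disjoint (map-++ᵛ-disjoint a (Disjoint-sym even#odd)) (map-++ᵛ-apart (a≢b ∘ sym))))
      (Disjoint-sym (++-disjoint (map-++ᵛ-apart a≢b) (map-++ᵛ-disjoint b even#odd)))

  count-choices : ∀ (q : Subset m) (S : Subset n) (X Y : List (Subset n)) →
    count (q ++ᵛ S) (map (a ++ᵛ_) X ++ map (b ++ᵛ_) Y) ≡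
    (if does (q ⊆? a) then count S X else 0) + (if does (q ⊆? b) then count S Y else 0)
  count-choices q S X Y =
    trans (count-++ (q ++ᵛ S) (map (a ++ᵛ_) X) _)
          (cong₂ _+_ (count-map-++ᵛ q a S X) (count-map-++ᵛ q b S Y))

  choices-balanced : ∀ n (S : Subset (n * m)) → ∣ S ∣ < n →
                     count S (evenChoices n) ≡ count S (oddChoices n)
  choices-balanced (suc n) S ∣S∣<1+n with q , S′ , refl ← splitAt m S = begin
    count (q ++ᵛ S′) (evenChoices (suc n))
      ≡⟨ count-choices q S′ (evenChoices n) (oddChoices n) ⟩
    (if does (q ⊆? a) then e else 0) + (if does (q ⊆? b) then o else 0)
      ≡⟨ exchange (⊥-or-nonempty q) ⟩
    (if does (q ⊆? a) then o else 0) + (if does (q ⊆? b) then e else 0)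
      ≡⟨ count-choices q S′ (oddChoices n) (evenChoices n) ⟨
    count (q ++ᵛ S′) (oddChoices (suc n)) ∎
    where
    open ≡-Reasoning
    e = count S′ (evenChoices n)
    o = count S′ (oddChoices n)
    ∣S′∣<n : 0 < ∣ q ∣ → ∣ S′ ∣ < n
    ∣S′∣<n 0<∣q∣ =
      s<s⁻¹ (≤-<-trans (+-monoˡ-≤ ∣ S′ ∣ 0<∣q∣) (subst (_< suc n) (∣p++q∣≡∣p∣+∣q∣ q S′) ∣S∣<1+n))
    exchange : q ≡ ⊥ ⊎ 0 < ∣ q ∣ →
      (if does (q ⊆? a) then e else 0) + (if does (q ⊆? b) then o else 0) ≡
      (if does (q ⊆? a) then o else 0) + (if does (q ⊆? b) then e else 0)
    exchange (inj₁ refl) rewrite dec-true (⊥ ⊆? a) (⊆-min a) | dec-true (⊥ ⊆? b) (⊆-min b) = +-comm e o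
    exchange (inj₂ 0<∣q∣) rewrite choices-balanced n S′ (∣S′∣<n 0<∣q∣) = refl

pointSum : ℕ → Subset n → ℕ
pointSum o []            = 0
pointSum o (inside  ∷ B) = suc o + pointSum (suc o) B
pointSum o (outside ∷ B) = pointSum (suc o) B

filter-∈-map-suc : ∀ s (B : Subset n) L → filter (_∈? (s ∷ B)) (map suc L) ≡ map suc (filter (_∈? B) L)
filter-∈-map-suc s B []      = refl
filter-∈-map-suc s B (i ∷ L) with does (i ∈? B)
... | true  = cong (suc i ∷_) (filter-∈-map-suc s B L)
... | false = filter-∈-map-suc s B L

sum-filter-∈-∷ : ∀ s (B : Subset n) (f : Fin (suc n) → ℕ) →
                 sum (map f (filter (_∈? (s ∷ B)) (tabulate suc))) ≡
                 sum (map (f ∘ suc) (filter (_∈? B) (allFin n)))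
sum-filter-∈-∷ {n} s B f = begin
  sum (map f (filter (_∈? (s ∷ B)) (tabulate suc)))
    ≡⟨ cong (sum ∘ map f ∘ filter (_∈? (s ∷ B))) (map-tabulate id suc) ⟨
  sum (map f (filter (_∈? (s ∷ B)) (map suc (allFin n))))
    ≡⟨ cong (sum ∘ map f) (filter-∈-map-suc s B (allFin n)) ⟩
  sum (map f (map suc (filter (_∈? B) (allFin n))))
    ≡⟨ cong sum (map-∘ (filter (_∈? B) (allFin n))) ⟨
  sum (map (f ∘ suc) (filter (_∈? B) (allFin n))) ∎
  where open ≡-Reasoning

offset-suc : ∀ o (f : Fin (suc n) → ℕ) → (∀ i → f i ≡ suc (toℕ i + o)) →
             ∀ i → f (suc i) ≡ suc (toℕ i + suc o)
offset-suc o f f≗ i = trans (f≗ (suc i)) (cong suc (sym (+-suc (toℕ i) o)))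

sum-filter-∈ : ∀ o (B : Subset n) (f : Fin n → ℕ) → (∀ i → f i ≡ suc (toℕ i + o)) →
               sum (map f (filter (_∈? B) (allFin n))) ≡ pointSum o B
sum-filter-∈ o []            f f≗ = refl
sum-filter-∈ o (inside  ∷ B) f f≗ =
  cong₂ _+_ (f≗ zero)
    (trans (sum-filter-∈-∷ inside B f) (sum-filter-∈ (suc o) B (f ∘ suc) (offset-suc o f f≗)))
sum-filter-∈ o (outside ∷ B) f f≗ =
  trans (sum-filter-∈-∷ outside B f) (sum-filter-∈ (suc o) B (f ∘ suc) (offset-suc o f f≗))

blockSum≡pointSum : (B : Subset n) → blockSum B ≡ pointSum 0 B
blockSum≡pointSum B = sum-filter-∈ 0 B (suc ∘ toℕ) (λ i → cong suc (sym (+-identityʳ (toℕ i))))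

outerPair innerPair : Subset 4
outerPair = inside ∷ outside ∷ outside ∷ inside ∷ []
innerPair = outside ∷ inside ∷ inside ∷ outside ∷ []

pointSum-outerPair : ∀ o (B : Subset n) → pointSum o (outerPair ++ᵛ B) ≡ 2 * o + 5 + pointSum (4 + o) B
pointSum-outerPair o B = arith o (pointSum (4 + o) B)
  where
  arith : ∀ o x → suc o + (suc (suc (suc (suc o))) + x) ≡ 2 * o + 5 + x
  arith = solve-∀

pointSum-innerPair : ∀ o (B : Subset n) → pointSum o (innerPair ++ᵛ B) ≡ 2 * o + 5 + pointSum (4 + o) B
pointSum-innerPair o B = arith o (pointSum (4 + o) B)
  where
  arith : ∀ o x → suc (suc o) + (suc (suc (suc o)) + x) ≡ 2 * o + 5 + x
  arith = solve-∀

open Choices outerPair innerPair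

-- The i-th pair, at offset o + 4i, contributes 2(o + 4i) + 5.
HasPointSum : ∀ n → Subset (n * 4) → Set
HasPointSum n B = ∀ o → pointSum o B ≡ n * (2 * o + 4 * n + 1)

pointSum-choices : ∀ n → All (HasPointSum n) (evenChoices n) × All (HasPointSum n) (oddChoices n)
pointSum-choices = All-choices HasPointSum (λ _ → refl) λ {n} {B} sum-B →
  (λ o → trans (pointSum-outerPair o B) (step o n (sum-B (4 + o)))) ,
  (λ o → trans (pointSum-innerPair o B) (step o n (sum-B (4 + o))))
  where
  step : ∀ o n {x} → x ≡ n * (2 * (4 + o) + 4 * n + 1) → 2 * o + 5 + x ≡ suc n * (2 * o + 4 * suc n + 1)
  step o n refl = arith o n
    where
    arith : ∀ o n → 2 * o + 5 + n * (2 * (4 + o) + 4 * n + 1) ≡ (1 + n) * (2 * o + 4 * (1 + n) + 1)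
    arith = solve-∀

PerfectMinimalTrade : (t n v : ℕ) → Set
PerfectMinimalTrade t n v = Σ (List (Block v)) λ T₁ → Σ (List (Block v)) λ T₂ →
  IsMinimalTrade v (2 * n) t T₁ T₂ ×
  volume T₁ ≡ 2 ^ t ×
  All (λ B → blockSum B ≡ n * (4 * t + 5)) T₁ ×
  All (λ B → blockSum B ≡ n * (4 * t + 5)) T₂

quadrupleTrade : ∀ t → PerfectMinimalTrade t (suc t) (suc t * 4)
quadrupleTrade t = evenChoices (suc t) , oddChoices (suc t) , (trade , minimal) , ∣even∣ ,
                   perfect (proj₁ (pointSum-choices (suc t))) , perfect (proj₂ (pointSum-choices (suc t)))
  where
  ∣even∣ = proj₁ (length-choices t)
  ∣odd∣  = proj₂ (length-choices t)
  distinct = choices-unique (λ ()) (suc t)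
  size : ∀ {X} → All (λ B → ∣ B ∣ ≡ suc t * 2) X → All (λ B → ∣ B ∣ ≡ 2 * suc t) X
  size = All.map (λ ∣B∣ → trans ∣B∣ (*-comm (suc t) 2))

  trade : IsTrade (suc t * 4) (2 * suc t) t (evenChoices (suc t)) (oddChoices (suc t))
  trade = record
    { k-pos      = z<s
    ; k<v        = subst (2 * suc t <_) (*-comm 4 (suc t)) (*-monoˡ-< (suc t) {2} {4} (s<s (s<s z<s)))
    ; uniq₁      = proj₁ distinct
    ; uniq₂      = proj₁ (proj₂ distinct)
    ; size₁      = size (proj₁ (∣choices∣ refl refl (suc t)))
    ; size₂      = size (proj₂ (∣choices∣ refl refl (suc t)))
    ; sameVolume = trans ∣even∣ (sym ∣odd∣)
    ; nonempty   = λ even≡[] → <⇒≢ (m^n>0 2 t) (trans (sym (cong length even≡[])) ∣even∣)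
    ; disjoint   = All.tabulate λ B∈even B∈odd → proj₂ (proj₂ distinct) (B∈even , B∈odd)
    ; balanced   = λ S ∣S∣≡t → choices-balanced (suc t) S (s≤s (≤-reflexive ∣S∣≡t))
    }

  minimal : ∀ S₁ S₂ → IsTrade (suc t * 4) (2 * suc t) t S₁ S₂ → volume (evenChoices (suc t)) ≤ volume S₁
  minimal S₁ S₂ trade′ =
    subst (_≤ volume S₁) (sym ∣even∣) (IsTrade⇒2^t≤volume trade′ (≤-trans (n≤1+n t) (m≤m+n (suc t) _)))

  perfect : ∀ {X} → All (HasPointSum (suc t)) X → All (λ B → blockSum B ≡ suc t * (4 * t + 5)) X
  perfect = All.map λ {B} sum-B → trans (blockSum≡pointSum B) (trans (sum-B 0) (arith t))
    where
    arith : ∀ t → suc t * (2 * 0 + 4 * suc t + 1) ≡ suc t * (4 * t + 5)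
    arith = solve-∀

lemma1 : (t : ℕ) → 1 ≤ t →
    Σ (List (Block (4 * (t + 1)))) λ T1 → Σ (List (Block (4 * (t + 1)))) λ T2 →
      IsMinimalTrade (4 * (t + 1)) (2 * (t + 1)) t T1 T2 ×
      volume T1 ≡ 2 ^ t ×
      All (λ B → blockSum B ≡ (t + 1) * (4 * t + 5)) T1 ×
      All (λ B → blockSum B ≡ (t + 1) * (4 * t + 5)) T2
-- The construction also works for t = 0.
lemma1 t _ =
  subst (λ n → PerfectMinimalTrade t n (4 * n)) (+-comm 1 t)
    (subst (PerfectMinimalTrade t (suc t)) (*-comm (suc t) 4) (quadrupleTrade t))
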